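{- For each finite graph $G=(V,E)$, $v(G)\ge\max\{k(U): U\subseteq V\text{ independent}\}$; in particular $2\alpha(G)\le v(G)$.
   Context: For a vertex $a$, $G_a$ denotes the subgraph induced on the neighbourhood of $a$. For a graph $H$, $\theta(H)$ is the minimum number of cliques needed to partition its vertex set ($\theta=0$ for the empty graph). Set $k(a)=\max\{\theta(G_a),2\}$ and $k(U)=\sum_{a\in U}k(a)$. $\alpha(G)$ is the independence number. $v(G)$ is the minimum number of points of a linear hypergraph (finite point set, lines are subsets of size $\ge2$, two distinct points in at most one line) whose intersection graph (vertices = lines, adjacent iff distinct and intersecting) is isomorphic to $G$. -}

module Defs where

open import Data.Nat using (ℕ; zero; suc; _+_; _*_; _≤_; _⊔_)
open import Data.Fin using (Fin; zero; suc)
open import Data.Fin.Subset using (Subset; _∈_; _∉_; _∩_; ∣_∣)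
open import Data.Product using (Σ; ∃; _×_; _,_)
open import Relation.Binary.PropositionalEquality using (_≡_; _≢_)
open import Relation.Nullary using (¬_)
open import Function.Bundles using (_⇔_)
open import Data.Bool using (true; false)
open import Data.Vec using (_∷_; [])

record Graph (n : ℕ) : Set₁ where
  field
    Adj     : Fin n → Fin n → Set
    sym     : ∀ {u v} → Adj u v → Adj v u
    irrefl  : ∀ {u} → ¬ Adj u u
open Graph public

Independent : ∀ {n} → Graph n → Subset n → Set
Independent G U = ∀ u v → u ∈ U → v ∈ U → ¬ Adj G u v

IsIndependenceNumber : ∀ {n} → Graph n → ℕ → Set
IsIndependenceNumber {n} G α =
  (Σ (Subset n) λ U → Independent G U × ∣ U ∣ ≡ α) ×
  (∀ U → Independent G U → ∣ U ∣ ≤ α)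

-- A partition of the vertex set of G_a (the subgraph induced on the
-- neighbourhood of a) into c cliques: every neighbour b of a gets a class
-- f b ∈ Fin c, and distinct neighbours in the same class are adjacent.
CliquePartitionNbhd : ∀ {n} → Graph n → Fin n → ℕ → Set
CliquePartitionNbhd {n} G a c =
  Σ ((b : Fin n) → Adj G a b → Fin c) λ f →
    ∀ b b' (p : Adj G a b) (p' : Adj G a b') →
      f b p ≡ f b' p' → b ≢ b' → Adj G b b'

IsThetaNbhd : ∀ {n} → Graph n → Fin n → ℕ → Set
IsThetaNbhd G a t =
  CliquePartitionNbhd G a t × (∀ c → CliquePartitionNbhd G a c → t ≤ c)

sumOver : ∀ {n} → Subset n → (Fin n → ℕ) → ℕ
sumOver []          f = 0
sumOver (true ∷ U)  f = f zero + sumOver U (λ i → f (suc i))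
sumOver (false ∷ U) f = sumOver U (λ i → f (suc i))

kSum : ∀ {n} → (Fin n → ℕ) → Subset n → ℕ
kSum θ U = sumOver U (λ a → θ a ⊔ 2)

-- A linear hypergraph on the point set Fin m whose lines are L v (v ∈ Fin n),
-- whose intersection graph is G (the isomorphism being v ↦ L v).
-- Lines have ≥ 2 points; two distinct lines share at most one point
-- (this also forces distinct indices to give distinct lines).
Represents : ∀ {n} → Graph n → (m : ℕ) → (Fin n → Subset m) → Set
Represents {n} G m' L =
  (∀ v → 2 ≤ ∣ L v ∣) ×
  (∀ u v → u ≢ v → ∣ L u ∩ L v ∣ ≤ 1) ×
  (∀ u v → u ≢ v → (Adj G u v ⇔ (∃ λ (p : Fin m') → p ∈ L u × p ∈ L v)))

RepresentableWith : ∀ {n} → Graph n → ℕ → Set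
RepresentableWith {n} G m = Σ (Fin n → Subset m) (Represents G m)

IsV : ∀ {n} → Graph n → ℕ → Set
IsV G m = RepresentableWith G m × (∀ m' → RepresentableWith G m' → m ≤ m')

{-# OPTIONS --safe #-}
module Submission where

-- Fix a representation of G by lines L a on m points. The neighbours of a
-- meet the line L a, and two neighbours meeting it in the same point are
-- adjacent, so the points of L a index a clique partition of G_a; hence
-- k(a) ≤ ∣ L a ∣, using also ∣ L a ∣ ≥ 2. The lines of an independent set
-- are pairwise disjoint, so their sizes add up to at most m.

open import Defs hiding (sym)
open import Data.Nat using (ℕ; _≤_; _*_; _+_; z≤n)
import Data.Nat as ℕ
open import Data.Nat.Properties using (+-monoʳ-≤; +-mono-≤; +-suc; ⊔-lub; *-zeroʳ; *-suc; module ≤-Reasoning)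
open import Data.Fin using (Fin; zero; suc; _≟_)
open import Data.Fin.Properties using (suc-injective; 0≢1+n)
open import Data.Fin.Subset using (Subset; _∈_; _⊆_; _─_; ⊤; ∣_∣; inside; outside)
open import Data.Fin.Subset.Properties using (⊆⊤; ∣⊤∣≡n; drop-∷-⊆; x∈p∧x∉q⇒x∈p─q)
open import Data.Vec using ([]; _∷_; here; there)
open import Data.Product using (∃; _×_; _,_; proj₁; proj₂)
open import Data.Empty using (⊥-elim)
open import Relation.Nullary using (yes; no)
open import Relation.Binary.PropositionalEquality
  using (_≡_; _≢_; refl; sym; cong; subst; module ≡-Reasoning)
open import Function.Bundles using (_⇔_; Equivalence)

position : ∀ {m} (S : Subset m) {p} → p ∈ S → Fin ∣ S ∣
position (inside ∷ S) here = zero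
position (inside ∷ S) (there p∈S) = suc (position S p∈S)
position (outside ∷ S) (there p∈S) = position S p∈S

position-injective : ∀ {m} (S : Subset m) {p q} (p∈S : p ∈ S) (q∈S : q ∈ S) →
  position S p∈S ≡ position S q∈S → p ≡ q
position-injective (inside ∷ S) here here _ = refl
position-injective (inside ∷ S) here (there _) ()
position-injective (inside ∷ S) (there _) here ()
position-injective (inside ∷ S) (there p∈S) (there q∈S) eq =
  cong suc (position-injective S p∈S q∈S (suc-injective eq))
position-injective (outside ∷ S) (there p∈S) (there q∈S) eq =
  cong suc (position-injective S p∈S q∈S eq)

p⊆q⇒∣p∣+∣q─p∣≡∣q∣ : ∀ {m} (p q : Subset m) → p ⊆ q → ∣ p ∣ + ∣ q ─ p ∣ ≡ ∣ q ∣
p⊆q⇒∣p∣+∣q─p∣≡∣q∣ []            []            _   = refl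
p⊆q⇒∣p∣+∣q─p∣≡∣q∣ (inside ∷ p)  (inside ∷ q)  p⊆q =
  cong ℕ.suc (p⊆q⇒∣p∣+∣q─p∣≡∣q∣ p q (drop-∷-⊆ p⊆q))
p⊆q⇒∣p∣+∣q─p∣≡∣q∣ (inside ∷ p)  (outside ∷ q) p⊆q with p⊆q here
... | ()
p⊆q⇒∣p∣+∣q─p∣≡∣q∣ (outside ∷ p) (inside ∷ q)  p⊆q = begin
  ∣ p ∣ + ℕ.suc ∣ q ─ p ∣   ≡⟨ +-suc ∣ p ∣ ∣ q ─ p ∣ ⟩
  ℕ.suc (∣ p ∣ + ∣ q ─ p ∣) ≡⟨ cong ℕ.suc (p⊆q⇒∣p∣+∣q─p∣≡∣q∣ p q (drop-∷-⊆ p⊆q)) ⟩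
  ℕ.suc ∣ q ∣             ∎
  where open ≡-Reasoning
p⊆q⇒∣p∣+∣q─p∣≡∣q∣ (outside ∷ p) (outside ∷ q) p⊆q =
  p⊆q⇒∣p∣+∣q─p∣≡∣q∣ p q (drop-∷-⊆ p⊆q)

sumOver-mono : ∀ {n} (U : Subset n) {f g : Fin n → ℕ} →
  (∀ {a} → a ∈ U → f a ≤ g a) → sumOver U f ≤ sumOver U g
sumOver-mono []            f≤g = z≤n
sumOver-mono (inside ∷ U)  f≤g = +-mono-≤ (f≤g here) (sumOver-mono U (λ a∈U → f≤g (there a∈U)))
sumOver-mono (outside ∷ U) f≤g = sumOver-mono U (λ a∈U → f≤g (there a∈U))

sumOver-const : ∀ {n} (U : Subset n) (c : ℕ) → sumOver U (λ _ → c) ≡ c * ∣ U ∣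
sumOver-const []            c = sym (*-zeroʳ c)
sumOver-const (inside ∷ U)  c = begin
  c + sumOver U (λ _ → c) ≡⟨ cong (c +_) (sumOver-const U c) ⟩
  c + c * ∣ U ∣           ≡⟨ sym (*-suc c ∣ U ∣) ⟩
  c * ℕ.suc ∣ U ∣         ∎
  where open ≡-Reasoning
sumOver-const (outside ∷ U) c = sumOver-const U c

PairwiseDisjointOn : ∀ {n m} → Subset n → (Fin n → Subset m) → Set
PairwiseDisjointOn U L = ∀ {a b p} → a ∈ U → b ∈ U → p ∈ L a → p ∈ L b → a ≡ b

PairwiseDisjointOn-tail : ∀ {n m x} {U : Subset n} {L : Fin (ℕ.suc n) → Subset m} →
  PairwiseDisjointOn (x ∷ U) L → PairwiseDisjointOn U (λ a → L (suc a))
PairwiseDisjointOn-tail disjoint a∈U b∈U p∈La p∈Lb =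
  suc-injective (disjoint (there a∈U) (there b∈U) p∈La p∈Lb)

sumOver-disjoint-∣∣≤ : ∀ {n m} (U : Subset n) (L : Fin n → Subset m) {W : Subset m} →
  (∀ {a} → a ∈ U → L a ⊆ W) → PairwiseDisjointOn U L →
  sumOver U (λ a → ∣ L a ∣) ≤ ∣ W ∣
sumOver-disjoint-∣∣≤ [] L _ _ = z≤n
sumOver-disjoint-∣∣≤ (outside ∷ U) L L⊆W disjoint =
  sumOver-disjoint-∣∣≤ U (λ a → L (suc a)) (λ a∈U → L⊆W (there a∈U)) (PairwiseDisjointOn-tail disjoint)
sumOver-disjoint-∣∣≤ (inside ∷ U) L {W} L⊆W disjoint = begin
  ∣ L zero ∣ + sumOver U (λ a → ∣ L (suc a) ∣) ≤⟨ +-monoʳ-≤ ∣ L zero ∣ rest≤ ⟩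
  ∣ L zero ∣ + ∣ W ─ L zero ∣                 ≡⟨ p⊆q⇒∣p∣+∣q─p∣≡∣q∣ (L zero) W (L⊆W here) ⟩
  ∣ W ∣                                       ∎
  where
  open ≤-Reasoning
  rest⊆W─L₀ : ∀ {a} → a ∈ U → L (suc a) ⊆ W ─ L zero
  rest⊆W─L₀ a∈U p∈La = x∈p∧x∉q⇒x∈p─q (L⊆W (there a∈U) p∈La)
    (λ p∈L₀ → 0≢1+n (disjoint here (there a∈U) p∈L₀ p∈La))

  rest≤ : sumOver U (λ a → ∣ L (suc a) ∣) ≤ ∣ W ─ L zero ∣
  rest≤ = sumOver-disjoint-∣∣≤ U (λ a → L (suc a)) rest⊆W─L₀ (PairwiseDisjointOn-tail disjoint)

module _ {n} (G : Graph n) {m} (L : Fin n → Subset m) (rep : Represents G m L) where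

  private
    adjacent⇔meet : ∀ {a b} → a ≢ b → Adj G a b ⇔ ∃ λ p → p ∈ L a × p ∈ L b
    adjacent⇔meet = proj₂ (proj₂ rep) _ _

  meeting-point : ∀ {a b} → Adj G a b → ∃ λ p → p ∈ L a × p ∈ L b
  meeting-point adj = Equivalence.to (adjacent⇔meet (λ { refl → irrefl G adj })) adj

  line-cliquePartitionNbhd : ∀ a → CliquePartitionNbhd G a ∣ L a ∣
  line-cliquePartitionNbhd a = class , same-class⇒adjacent
    where
    class : ∀ b → Adj G a b → Fin ∣ L a ∣
    class b adj = position (L a) (proj₁ (proj₂ (meeting-point adj)))

    same-class⇒adjacent : ∀ b b' (adj : Adj G a b) (adj' : Adj G a b') →
      class b adj ≡ class b' adj' → b ≢ b' → Adj G b b'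
    same-class⇒adjacent b b' adj adj' eq b≢b' with meeting-point adj | meeting-point adj'
    ... | p , p∈La , p∈Lb | p' , p'∈La , p'∈Lb' =
      Equivalence.from (adjacent⇔meet b≢b')
        (p , p∈Lb , subst (_∈ L b') (sym (position-injective (L a) p∈La p'∈La eq)) p'∈Lb')

  independent⇒lines-disjoint : ∀ U → Independent G U → PairwiseDisjointOn U L
  independent⇒lines-disjoint U indep {a} {b} {p} a∈U b∈U p∈La p∈Lb with a ≟ b
  ... | yes a≡b = a≡b
  ... | no  a≢b = ⊥-elim (indep a b a∈U b∈U (Equivalence.from (adjacent⇔meet a≢b) (p , p∈La , p∈Lb)))

  sumOver-independent≤ : ∀ U → Independent G U → {f : Fin n → ℕ} →
    (∀ {a} → a ∈ U → f a ≤ ∣ L a ∣) → sumOver U f ≤ m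
  sumOver-independent≤ U indep {f} f≤∣L∣ = begin
    sumOver U f                   ≤⟨ sumOver-mono U f≤∣L∣ ⟩
    sumOver U (λ a → ∣ L a ∣)     ≤⟨ sumOver-disjoint-∣∣≤ U L (λ _ → ⊆⊤) (independent⇒lines-disjoint U indep) ⟩
    ∣ ⊤ {m} ∣                     ≡⟨ ∣⊤∣≡n m ⟩
    m                             ∎
    where open ≤-Reasoning

mainTheorem17 : ∀ {n} (G : Graph n) (vG : ℕ) → IsV G vG →
    (∀ (θ : Fin n → ℕ) → (∀ a → IsThetaNbhd G a (θ a)) →
       ∀ (U : Subset n) → Independent G U → kSum θ U ≤ vG)
    × (∀ α → IsIndependenceNumber G α → 2 * α ≤ vG)
mainTheorem17 G vG ((L , rep) , _) = kSum≤ , twice-α≤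
  where
  two≤∣L∣ : ∀ a → 2 ≤ ∣ L a ∣
  two≤∣L∣ = proj₁ rep

  kSum≤ : ∀ θ → (∀ a → IsThetaNbhd G a (θ a)) → ∀ U → Independent G U → kSum θ U ≤ vG
  kSum≤ θ isθ U indep = sumOver-independent≤ G L rep U indep
    (λ {a} _ → ⊔-lub (proj₂ (isθ a) _ (line-cliquePartitionNbhd G L rep a)) (two≤∣L∣ a))

  twice-α≤ : ∀ α → IsIndependenceNumber G α → 2 * α ≤ vG
  twice-α≤ _ ((U , indep , refl) , _) =
    subst (_≤ vG) (sumOver-const U 2) (sumOver-independent≤ G L rep U indep (λ {a} _ → two≤∣L∣ a))
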